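{- Let $k\ge 3$ be an integer. If a finite simple graph $G$ is $k$-edge-connected and has matching number greater than $k$, then $G$ contains a matching $M$ of cardinality $k$ such that $G-M$ (the graph obtained by deleting the edges of $M$) is connected.
   Context: The matching number of a graph is the maximum cardinality of a set of pairwise non-adjacent edges (a matching). -}

module Defs where

open import Level using (0ℓ)
open import Data.Nat using (ℕ; _<_)
open import Data.Fin using (Fin) renaming (_<_ to _<ᶠ_)
open import Data.Product using (_×_; _,_; Σ)
open import Data.List using (List; length)
open import Data.List.Membership.Propositional using (_∈_)
open import Data.List.Relation.Unary.All using (All)
open import Data.List.Relation.Unary.AllPairs using (AllPairs)
open import Data.List.Relation.Unary.Unique.Propositional using (Unique)
open import Relation.Nullary using (¬_)
open import Relation.Binary.PropositionalEquality using (_≡_; _≢_)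
open import Relation.Binary.Construct.Closure.ReflexiveTransitive using (Star)

record Graph : Set₁ where
  field
    n      : ℕ
    Adj    : Fin n → Fin n → Set
    sym    : ∀ {u v} → Adj u v → Adj v u
    irrefl : ∀ u → ¬ Adj u u
open Graph public

-- An edge {u,v} is represented canonically by the pair (u , v) with u < v.
VPair : Graph → Set
VPair G = Fin (n G) × Fin (n G)

IsEdge : (G : Graph) → VPair G → Set
IsEdge G (u , v) = (u <ᶠ v) × Adj G u v

IsEdgeSet : (G : Graph) → List (VPair G) → Set
IsEdgeSet G F = All (IsEdge G) F × Unique F

_─_ : (G : Graph) → List (VPair G) → Graph
G ─ F = record
  { n      = n G
  ; Adj    = λ u v → Adj G u v × ¬ ((u , v) ∈ F) × ¬ ((v , u) ∈ F)
  ; sym    = λ { (a , p , q) → sym G a , q , p }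
  ; irrefl = λ u h → irrefl G u (Data.Product.proj₁ h)
  }

Connected : Graph → Set
Connected G = ∀ (u v : Fin (n G)) → Star (Adj G) u v

EdgeConnected : ℕ → Graph → Set
EdgeConnected k G =
  ∀ (F : List (VPair G)) → IsEdgeSet G F → length F < k → Connected (G ─ F)

Disjoint : (G : Graph) → VPair G → VPair G → Set
Disjoint G (a , b) (c , d) = (a ≢ c) × (a ≢ d) × (b ≢ c) × (b ≢ d)

IsMatching : (G : Graph) → List (VPair G) → Set
IsMatching G M = IsEdgeSet G M × AllPairs (Disjoint G) M

MatchingNumber> : Graph → ℕ → Set
MatchingNumber> G k = Σ (List (VPair G)) λ M → IsMatching G M × k < length M

-- Split a matching with more than k edges as e₁ = ab, e₂ = cd and k − 1 further edges C.
-- G − C is connected, so G − (eᵢ ∷ C) is connected as soon as the ends of eᵢ are joined in it.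
-- If this fails for both i, each failure yields a cut: a 2-colouring separating the ends of eᵢ
-- and constant across every edge outside eᵢ ∷ C. Since G − (eᵢ ∷ C ∖ g) is connected for each
-- g ∈ C, every edge of C crosses both cuts, so the sum of the two colourings is constant across
-- every edge except e₁ and e₂, hence along an a–b walk in G − {e₁, e₂}. But the first colouring
-- separates a from b and the second does not (e₁ lies outside e₂ ∷ C).
-- Adjacency in G is not decidable, so the colourings are computed in the finite subgraph
-- spanned by the walks the argument uses.

{-# OPTIONS --safe #-}
module Submission where

open import Level using (Level)
open import Data.Bool using (Bool; true; false; _xor_)
open import Data.Empty using (⊥-elim)
open import Data.Fin using (Fin) renaming (_≟_ to _≟ᶠ_)
open import Data.Fin.Properties using (any?)
open import Data.Fin.Subset using (Subset; ⁅_⁆; _∪_; _⊂_; _⊃_) renaming (_∈_ to _∈ₛ_; _∉_ to _∉ₛ_)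
open import Data.Fin.Subset.Properties using (x∈p∪q⁺; x∈p∪q⁻; x∈⁅x⁆; x∈⁅y⁆⇒x≡y; p⊆p∪q)
  renaming (_∈?_ to _∈ₛ?_)
open import Data.Fin.Subset.Induction using (⊃-wellFounded; Acc; acc)
open import Data.Nat using (ℕ; suc; _≤_; _<_; s≤s; z≤n)
open import Data.Nat.Properties using (≤-trans; ≤-reflexive; n<1+n; m≤n⇒m⊓n≡m)
open import Data.Product using (Σ; ∃₂; _×_; _,_; proj₁; proj₂; uncurry)
open import Data.Product.Properties using (≡-dec)
open import Data.Sum using (_⊎_; inj₁; inj₂; [_,_]; [_,_]′)
import Data.Sum as Sum
open import Data.List using (List; []; _∷_; length; take; filter; _++_)
open import Data.List.Properties using (length-take; filter-notAll)
open import Data.List.Membership.Propositional using (_∈_; _∉_)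
open import Data.List.Membership.Propositional.Properties using (∈-filter⁺; ∈-++⁺ˡ; ∈-++⁺ʳ)
open import Data.List.Relation.Unary.Any using (here; there)
import Data.List.Relation.Unary.Any as Any
open import Data.List.Relation.Unary.All using (All; []; _∷_)
import Data.List.Relation.Unary.All as All
open import Data.List.Relation.Unary.All.Properties using (++⁺)
open import Data.List.Relation.Unary.AllPairs using (AllPairs; []; _∷_)
open import Data.List.Relation.Binary.Sublist.Propositional using ([]; _∷_; _∷ʳ_; ⊆-refl; minimum)
  renaming (_⊆_ to _⊑_)
open import Data.List.Relation.Binary.Sublist.Propositional.Properties using (All-resp-⊆; take-⊆; filter-⊆)
open import Function using (_∘_)
open import Relation.Binary.Core using (Rel; _⇒_; _Preserves_⟶_)
open import Relation.Binary.Definitions using (Decidable; Symmetric)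
open import Relation.Binary.PropositionalEquality using (_≡_; _≢_; refl; trans; cong; cong₂; subst)
  renaming (sym to ≡-sym)
open import Relation.Binary.Construct.Closure.ReflexiveTransitive using (Star; ε; _◅_; _⋆; return; reverse)
import Relation.Binary.Construct.Closure.ReflexiveTransitive as Star
open import Relation.Nullary using (¬_; Dec; yes; no; ¬?; does)
open import Relation.Nullary.Decidable using (_×-dec_; _⊎-dec_; dec-true; dec-false; decidable-stable)

open import Defs

xor-flip : ∀ {a b c d} → a ≢ b → c ≢ d → a xor c ≡ b xor d
xor-flip {false} {true}  {false} {true}  _ _ = refl
xor-flip {false} {true}  {true}  {false} _ _ = refl
xor-flip {true}  {false} {false} {true}  _ _ = refl
xor-flip {true}  {false} {true}  {false} _ _ = refl
xor-flip {false} {false} a≢b _ = ⊥-elim (a≢b refl)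
xor-flip {true}  {true}  a≢b _ = ⊥-elim (a≢b refl)
xor-flip {c = false} {false} _ c≢d = ⊥-elim (c≢d refl)
xor-flip {c = true}  {true}  _ c≢d = ⊥-elim (c≢d refl)

xor-cancelʳ : ∀ {a b c d} → a xor c ≡ b xor d → c ≡ d → a ≡ b
xor-cancelʳ {false} {false} _ _ = refl
xor-cancelʳ {true}  {true}  _ _ = refl
xor-cancelʳ {false} {true}  {false} () refl
xor-cancelʳ {false} {true}  {true}  () refl
xor-cancelʳ {true}  {false} {false} () refl
xor-cancelʳ {true}  {false} {true}  () refl

AllPairs-resp-⊑ : ∀ {a r} {A : Set a} {R : Rel A r} {xs ys} → xs ⊑ ys → AllPairs R ys → AllPairs R xs
AllPairs-resp-⊑ []         []         = []
AllPairs-resp-⊑ (_ ∷ʳ τ)   (_ ∷ rys)  = AllPairs-resp-⊑ τ rys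
AllPairs-resp-⊑ (refl ∷ τ) (ry ∷ rys) = All-resp-⊆ τ ry ∷ AllPairs-resp-⊑ τ rys

module _ {a ℓ : Level} {A : Set a} {R : Rel A ℓ} where

  steps : ∀ {x y} → Star R x y → List (A × A)
  steps ε                 = []
  steps (_◅_ {u} {v} _ w) = (u , v) ∷ steps w

  steps-All : ∀ {x y} (w : Star R x y) → All (uncurry R) (steps w)
  steps-All ε       = []
  steps-All (r ◅ w) = r ∷ steps-All w

  constant-along : ∀ {b} {B : Set b} (f : A → B) {x y} (w : Star R x y) →
                   (∀ {u v} → (u , v) ∈ steps w → f u ≡ f v) → f x ≡ f y
  constant-along f ε       _ = refl
  constant-along f (_ ◅ w) h = trans (h (here refl)) (constant-along f w (h ∘ there))

module _ {a i ℓ : Level} {A : Set a} {I : Set i} {R : I → Rel A ℓ} {x y : A} where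

  concatSteps : (is : List I) → (∀ {i} → i ∈ is → Star (R i) x y) → List (A × A)
  concatSteps []       _ = []
  concatSteps (i ∷ is) w = steps (w (here refl)) ++ concatSteps is (w ∘ there)

  steps⊆concatSteps : ∀ {is} (w : ∀ {i} → i ∈ is → Star (R i) x y) {i} (i∈is : i ∈ is) {p} →
                      p ∈ steps (w i∈is) → p ∈ concatSteps is w
  steps⊆concatSteps w (here refl) = ∈-++⁺ˡ
  steps⊆concatSteps w (there i∈is) = ∈-++⁺ʳ _ ∘ steps⊆concatSteps (w ∘ there) i∈is

  concatSteps-All : ∀ {s} {S : Rel A s} → (∀ {i u v} → R i u v → S u v) →
                    ∀ is (w : ∀ {i} → i ∈ is → Star (R i) x y) → All (uncurry S) (concatSteps is w)
  concatSteps-All R⇒S []       w = []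
  concatSteps-All R⇒S (i ∷ is) w =
    ++⁺ (All.map R⇒S (steps-All (w (here refl)))) (concatSteps-All R⇒S is (w ∘ there))

module _ {m : ℕ} {ℓ : Level} {E : Rel (Fin m) ℓ} (E? : Decidable E) (a : Fin m) where

  record Component : Set ℓ where
    field
      members   : Subset m
      a∈        : a ∈ₛ members
      reachable : ∀ {x} → x ∈ₛ members → Star E a x
      closed    : ∀ {x y} → x ∈ₛ members → E x y → y ∈ₛ members

  private
    Escapes : Subset m → Set ℓ
    Escapes S = ∃₂ λ x y → x ∈ₛ S × y ∉ₛ S × E x y

    escapes? : ∀ S → Dec (Escapes S)
    escapes? S = any? λ x → any? λ y → x ∈ₛ? S ×-dec ¬? (y ∈ₛ? S) ×-dec E? x y

    grow : ∀ S → Acc _⊃_ S → a ∈ₛ S → (∀ {x} → x ∈ₛ S → Star E a x) → Component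
    grow S (acc larger) a∈S reach with escapes? S
    ... | no ¬esc = record
      { members   = S
      ; a∈        = a∈S
      ; reachable = reach
      ; closed    = λ {x} {y} x∈S xy → decidable-stable (y ∈ₛ? S) (λ y∉S → ¬esc (x , y , x∈S , y∉S , xy))
      }
    ... | yes (x , y , x∈S , y∉S , xy) =
      grow (S ∪ ⁅ y ⁆) (larger S⊂S∪y) (x∈p∪q⁺ (inj₁ a∈S)) reach′
      where
        S⊂S∪y : S ⊂ S ∪ ⁅ y ⁆
        S⊂S∪y = p⊆p∪q ⁅ y ⁆ , y , x∈p∪q⁺ (inj₂ (x∈⁅x⁆ y)) , y∉S

        reach′ : ∀ {z} → z ∈ₛ S ∪ ⁅ y ⁆ → Star E a z
        reach′ z∈ with x∈p∪q⁻ S ⁅ y ⁆ z∈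
        ... | inj₁ z∈S = reach z∈S
        ... | inj₂ z∈y with x∈⁅y⁆⇒x≡y y z∈y
        ...   | refl = reach x∈S Star.◅◅ return xy

  component : Component
  component = grow ⁅ a ⁆ (⊃-wellFounded _) (x∈⁅x⁆ a) from-a
    where
      from-a : ∀ {x} → x ∈ₛ ⁅ a ⁆ → Star E a x
      from-a x∈ with x∈⁅y⁆⇒x≡y a x∈
      ... | refl = ε

  open Component component

  reachable-or-separated : Symmetric E → ∀ b →
    Star E a b ⊎ Σ (Fin m → Bool) λ f → f a ≢ f b × f Preserves E ⟶ _≡_
  reachable-or-separated E-sym b with b ∈ₛ? members
  ... | yes b∈ = inj₁ (reachable b∈)
  ... | no b∉ = inj₂ (side , separates , side-E)
    where
      side : Fin m → Bool
      side x = does (x ∈ₛ? members)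

      separates : side a ≢ side b
      separates rewrite dec-true (a ∈ₛ? members) a∈ | dec-false (b ∈ₛ? members) b∉ = λ ()

      side-E : side Preserves E ⟶ _≡_
      side-E {u} {v} uv with u ∈ₛ? members | v ∈ₛ? members
      ... | yes _   | yes _   = refl
      ... | no _    | no _    = refl
      ... | yes u∈  | no v∉   = ⊥-elim (v∉ (closed u∈ uv))
      ... | no u∉   | yes v∈  = ⊥-elim (u∉ (closed v∈ (E-sym uv)))

module _ (G : Graph) where

  private
    V : Set
    V = Fin (n G)

    P : Set
    P = VPair G

  _≟ₚ_ : (p q : P) → Dec (p ≡ q)
  _≟ₚ_ = ≡-dec _≟ᶠ_ _≟ᶠ_

  open import Data.List.Membership.DecPropositional _≟ₚ_ using (_∈?_)

  _∖_ : List P → P → List P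
  C ∖ g = filter (λ q → ¬? (q ≟ₚ g)) C

  ∉∖⇒≡ : ∀ {q g C} → q ∈ C → q ∉ C ∖ g → q ≡ g
  ∉∖⇒≡ {q} {g} q∈C q∉C∖g = decidable-stable (q ≟ₚ g) (q∉C∖g ∘ ∈-filter⁺ (λ r → ¬? (r ≟ₚ g)) q∈C)

  ∖-shorter : ∀ {g C} → g ∈ C → length (C ∖ g) < length C
  ∖-shorter {g} {C} g∈C = filter-notAll (λ r → ¬? (r ≟ₚ g)) C (Any.map (λ g≡q q≢g → q≢g (≡-sym g≡q)) g∈C)

  SymIn : List P → Rel V _
  SymIn F u v = (u , v) ∈ F ⊎ (v , u) ∈ F

  symIn? : ∀ F → Decidable (SymIn F)
  symIn? F u v = ((u , v) ∈? F) ⊎-dec ((v , u) ∈? F)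

  ¬SymIn-∷ : ∀ {e F u v} → (u , v) ≢ e → (v , u) ≢ e → ¬ SymIn F u v → ¬ SymIn (e ∷ F) u v
  ¬SymIn-∷ uv≢e _    _    (inj₁ (here uv≡e)) = uv≢e uv≡e
  ¬SymIn-∷ _    vu≢e _    (inj₂ (here vu≡e)) = vu≢e vu≡e
  ¬SymIn-∷ _    _    ¬uv  (inj₁ (there uv∈F)) = ¬uv (inj₁ uv∈F)
  ¬SymIn-∷ _    _    ¬uv  (inj₂ (there vu∈F)) = ¬uv (inj₂ vu∈F)

  disjoint⇒¬SymIn : ∀ {a b F} → All (Disjoint G (a , b)) F → ¬ SymIn F a b
  disjoint⇒¬SymIn disj (inj₁ ab∈F) = proj₁ (All.lookup disj ab∈F) refl
  disjoint⇒¬SymIn disj (inj₂ ba∈F) = proj₁ (proj₂ (All.lookup disj ba∈F)) refl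

  edgeSet-resp-⊑ : ∀ {F F′} → F′ ⊑ F → IsEdgeSet G F → IsEdgeSet G F′
  edgeSet-resp-⊑ τ (edges , unique) = All-resp-⊆ τ edges , AllPairs-resp-⊑ τ unique

  matching-resp-⊑ : ∀ {M M′} → M′ ⊑ M → IsMatching G M → IsMatching G M′
  matching-resp-⊑ τ (edgeSet , disjoint) = edgeSet-resp-⊑ τ edgeSet , AllPairs-resp-⊑ τ disjoint

  edgeConnected-mono : ∀ {j k} → j ≤ k → EdgeConnected k G → EdgeConnected j G
  edgeConnected-mono j≤k conn F F-edges |F|<j = conn F F-edges (≤-trans |F|<j j≤k)

  reconnect : ∀ {a b C} → Connected (G ─ C) → Star (Adj (G ─ ((a , b) ∷ C))) a b →
              Connected (G ─ ((a , b) ∷ C))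
  reconnect {a} {b} {C} conn detour u v = (reroute ⋆) (conn u v)
    where
      ∉-∷ : ∀ {p} → p ≢ (a , b) → p ∉ C → p ∉ (a , b) ∷ C
      ∉-∷ p≢ab _    (here p≡ab) = p≢ab p≡ab
      ∉-∷ _    p∉C (there p∈C) = p∉C p∈C

      reroute : Adj (G ─ C) ⇒ Star (Adj (G ─ ((a , b) ∷ C)))
      reroute {x} {y} (xy , xy∉C , yx∉C) with (x , y) ≟ₚ (a , b) | (y , x) ≟ₚ (a , b)
      ... | yes refl | _        = detour
      ... | no _     | yes refl = reverse (sym (G ─ _)) detour
      ... | no xy≢ab | no yx≢ab = return (xy , ∉-∷ xy≢ab xy∉C , ∉-∷ yx≢ab yx∉C)

  bypass : ∀ {e C} → EdgeConnected (suc (length C)) G → IsEdgeSet G (e ∷ C) →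
           ∀ {g} → g ∈ C → Connected (G ─ (e ∷ C ∖ g))
  bypass {e} {C} conn eC {g} g∈C =
    conn (e ∷ C ∖ g) (edgeSet-resp-⊑ (refl ∷ filter-⊆ (λ r → ¬? (r ≟ₚ g)) C) eC) (s≤s (∖-shorter g∈C))

  only-restored : ∀ {e g C u v} → Adj (G ─ (e ∷ C ∖ g)) u v → SymIn (e ∷ C) u v →
                  (u , v) ≡ g ⊎ (v , u) ≡ g
  only-restored (_ , uv∉ , _) (inj₁ (here uv≡e))   = ⊥-elim (uv∉ (here uv≡e))
  only-restored (_ , _ , vu∉) (inj₂ (here vu≡e))   = ⊥-elim (vu∉ (here vu≡e))
  only-restored (_ , uv∉ , _) (inj₁ (there uv∈C)) = inj₁ (∉∖⇒≡ uv∈C (uv∉ ∘ there))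
  only-restored (_ , _ , vu∉) (inj₂ (there vu∈C)) = inj₂ (∉∖⇒≡ vu∈C (vu∉ ∘ there))

  Remaining : List P → List P → Rel V _
  Remaining L M u v = SymIn L u v × ¬ SymIn M u v

  remaining? : ∀ L M → Decidable (Remaining L M)
  remaining? L M u v = symIn? L u v ×-dec ¬? (symIn? M u v)

  remaining-sym : ∀ {L M} → Symmetric (Remaining L M)
  remaining-sym (uv∈L , uv∉M) = Sum.swap uv∈L , uv∉M ∘ Sum.swap

  remaining⇒Adj : ∀ {L M} → All (uncurry (Adj G)) L → Remaining L M ⇒ Adj (G ─ M)
  remaining⇒Adj L-edges (inj₁ uv∈L , uv∉M) = All.lookup L-edges uv∈L , uv∉M ∘ inj₁ , uv∉M ∘ inj₂
  remaining⇒Adj L-edges (inj₂ vu∈L , uv∉M) = sym G (All.lookup L-edges vu∈L) , uv∉M ∘ inj₁ , uv∉M ∘ inj₂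

  record Cut (x y : V) (C K : List P) : Set where
    field
      side      : V → Bool
      separates : side x ≢ side y
      crossed   : ∀ {p q} → (p , q) ∈ C → side p ≢ side q
      uncrossed : ∀ {u v} → SymIn K u v → ¬ SymIn ((x , y) ∷ C) u v → side u ≡ side v

    crossed-sym : ∀ {u v} → SymIn C u v → side u ≢ side v
    crossed-sym (inj₁ uv∈C) = crossed uv∈C
    crossed-sym (inj₂ vu∈C) = crossed vu∈C ∘ ≡-sym

  cut-or-reconnect : ∀ x y C K → All (uncurry (Adj G)) K →
    (detours : ∀ {g} → g ∈ C → Star (Adj (G ─ ((x , y) ∷ C ∖ g))) x y) →
    Star (Adj (G ─ ((x , y) ∷ C))) x y ⊎ Cut x y C K
  cut-or-reconnect x y C K K-edges detours =
    [ inj₁ ∘ Star.map (remaining⇒Adj L-edges) , inj₂ ∘ cut ]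
      (reachable-or-separated (remaining? L M) x remaining-sym y)
    where
      M : List P
      M = (x , y) ∷ C

      L : List P
      L = K ++ concatSteps {R = λ g → Adj (G ─ ((x , y) ∷ C ∖ g))} C detours

      L-edges : All (uncurry (Adj G)) L
      L-edges = ++⁺ K-edges (concatSteps-All proj₁ C detours)

      cut : (Σ (V → Bool) λ f → f x ≢ f y × f Preserves Remaining L M ⟶ _≡_) → Cut x y C K
      cut (f , fx≢fy , f-const) = record
        { side      = f
        ; separates = fx≢fy
        ; crossed   = crossed
        ; uncrossed = λ uv∈K → f-const ∘ (Sum.map ∈-++⁺ˡ ∈-++⁺ˡ uv∈K ,_)
        }
        where
          -- the detour for pq avoids every edge of M but pq, so it can change side only there
          crossed : ∀ {p q} → (p , q) ∈ C → f p ≢ f q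
          crossed pq∈C fp≡fq = fx≢fy (constant-along f (detours pq∈C) step)
            where
              step : ∀ {u v} → (u , v) ∈ steps (detours pq∈C) → f u ≡ f v
              step {u} {v} uv∈w with symIn? M u v
              ... | no uv∉M = f-const (inj₁ (∈-++⁺ʳ K (steps⊆concatSteps detours pq∈C uv∈w)) , uv∉M)
              ... | yes uv∈M with only-restored (All.lookup (steps-All (detours pq∈C)) uv∈w) uv∈M
              ...   | inj₁ refl = fp≡fq
              ...   | inj₂ refl = ≡-sym fp≡fq

  no-two-cuts : ∀ {a b c d C} (W : Star (Adj (G ─ ((a , b) ∷ (c , d) ∷ []))) a b) →
                ¬ SymIn ((c , d) ∷ C) a b →
                Cut a b C (steps W) → ¬ Cut c d C ((a , b) ∷ steps W)
  no-two-cuts {a} {b} {c} {d} {C} W ab∉cdC S T = S.separates (xor-cancelʳ F-ab T-ab)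
    where
      module S = Cut S
      module T = Cut T

      F : V → Bool
      F u = S.side u xor T.side u

      F-step : ∀ {u v} → (u , v) ∈ steps W → F u ≡ F v
      F-step {u} {v} uv∈W with symIn? C u v | All.lookup (steps-All W) uv∈W
      ... | yes uv∈C | _ = xor-flip (S.crossed-sym uv∈C) (T.crossed-sym uv∈C)
      ... | no uv∉C | (_ , uv∉ , vu∉) =
        cong₂ _xor_ (S.uncrossed (inj₁ uv∈W) (¬SymIn-∷ (uv∉ ∘ here) (vu∉ ∘ here) uv∉C))
                    (T.uncrossed (inj₁ (there uv∈W)) (¬SymIn-∷ (uv∉ ∘ there ∘ here) (vu∉ ∘ there ∘ here) uv∉C))

      F-ab : F a ≡ F b
      F-ab = constant-along F W F-step

      T-ab : T.side a ≡ T.side b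
      T-ab = T.uncrossed (inj₁ (here refl)) ab∉cdC

  two-candidates : ∀ {a b c d C} → 2 ≤ length C → EdgeConnected (suc (length C)) G →
                   IsMatching G ((a , b) ∷ (c , d) ∷ C) →
                   Connected (G ─ ((a , b) ∷ C)) ⊎ Connected (G ─ ((c , d) ∷ C))
  two-candidates {a} {b} {c} {d} {C} 2≤|C| conn (edgeSet , ab-disjoint ∷ _) =
    [ inj₁ ∘ reconnect connC , cut-at-ab ] (cut-or-reconnect a b C (steps W) W-edges (detour abC))
    where
      abC : IsEdgeSet G ((a , b) ∷ C)
      abC = edgeSet-resp-⊑ (refl ∷ (c , d) ∷ʳ ⊆-refl) edgeSet

      cdC : IsEdgeSet G ((c , d) ∷ C)
      cdC = edgeSet-resp-⊑ ((a , b) ∷ʳ ⊆-refl) edgeSet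

      connC : Connected (G ─ C)
      connC = conn C (edgeSet-resp-⊑ ((a , b) ∷ʳ (c , d) ∷ʳ ⊆-refl) edgeSet) (n<1+n _)

      W : Star (Adj (G ─ ((a , b) ∷ (c , d) ∷ []))) a b
      W = conn _ (edgeSet-resp-⊑ (refl ∷ refl ∷ minimum C) edgeSet) (s≤s 2≤|C|) a b

      W-edges : All (uncurry (Adj G)) (steps W)
      W-edges = All.map proj₁ (steps-All W)

      detour : ∀ {x y} → IsEdgeSet G ((x , y) ∷ C) → ∀ {g} → g ∈ C → Star (Adj (G ─ ((x , y) ∷ C ∖ g))) x y
      detour {x} {y} xyC g∈C = bypass conn xyC g∈C x y

      cut-at-ab : Cut a b C (steps W) → Connected (G ─ ((a , b) ∷ C)) ⊎ Connected (G ─ ((c , d) ∷ C))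
      cut-at-ab S =
        [ inj₂ ∘ reconnect connC , ⊥-elim ∘ no-two-cuts W (disjoint⇒¬SymIn ab-disjoint) S ]
          (cut-or-reconnect c d C ((a , b) ∷ steps W) (proj₂ (All.head (proj₁ abC)) ∷ W-edges) (detour cdC))

corollary2 : (k : ℕ) → 3 ≤ k → (G : Graph) → EdgeConnected k G → MatchingNumber> G k →
    Σ (List (VPair G)) λ M → IsMatching G M × length M ≡ k × Connected (G ─ M)
corollary2 (suc (suc (suc j))) (s≤s (s≤s (s≤s _))) G conn ((a , b) ∷ (c , d) ∷ rest , N , s≤s (s≤s j+2≤|rest|)) =
  [ (λ G─abC → (a , b) ∷ C , matching-resp-⊑ G (refl ∷ (c , d) ∷ʳ ⊆-refl) N′ , cong suc |C| , G─abC)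
  , (λ G─cdC → (c , d) ∷ C , matching-resp-⊑ G ((a , b) ∷ʳ ⊆-refl) N′ , cong suc |C| , G─cdC)
  ]′ (two-candidates G (subst (2 ≤_) (≡-sym |C|) (s≤s (s≤s z≤n)))
                      (edgeConnected-mono G (≤-reflexive (cong suc |C|)) conn) N′)
  where
    C : List (VPair G)
    C = take (suc (suc j)) rest

    |C| : length C ≡ suc (suc j)
    |C| = trans (length-take (suc (suc j)) rest) (m≤n⇒m⊓n≡m j+2≤|rest|)

    N′ : IsMatching G ((a , b) ∷ (c , d) ∷ C)
    N′ = matching-resp-⊑ G (refl ∷ refl ∷ take-⊆ (suc (suc j)) rest) N
corollary2 (suc (suc (suc j))) (s≤s (s≤s (s≤s _))) G conn ([] , _ , ())
corollary2 (suc (suc (suc j))) (s≤s (s≤s (s≤s _))) G conn (_ ∷ [] , _ , s≤s ())
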